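{- For every presheaf $F$ over a topological space $B$, $\mathrm{Hom}(F,\mathrm{Char}\,\emptyset)\cong\mathrm{Char}(\mathrm{Int}(B\setminus\mathrm{Supp}\,F))$.
   Context: A presheaf on $B$ is a functor from the open subsets of $B$ (with inclusions) to sets. $\mathrm{Supp}\,F$ is the union of all open $U$ with $F(U)\ne\emptyset$. $\mathrm{Hom}(F,G)(U)$ is the set of presheaf morphisms $F|_U\to G|_U$, with restriction. For open $W$, $\mathrm{Char}\,W$ is the presheaf with $(\mathrm{Char}\,W)(V)$ a one-point set if $V\subset W$ and empty otherwise. -}

module Defs where

open import Level using (0ℓ)
open import Relation.Unary using (Pred; _⊆_; _∈_; ∁)
open import Relation.Binary.Bundles using (Setoid)
open import Data.Product using (Σ; ∃; _×_; _,_; proj₁; proj₂)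
open import Data.Unit using (⊤; tt)

-- A topological space B, presented by a (small) type of codes for its open
-- sets together with their underlying subsets.
record Space : Set₁ where
  field
    Pt    : Set
    Opn   : Set
    ⟦_⟧   : Opn → Pred Pt 0ℓ
    whole : Opn
    whole-spec : ∀ x → x ∈ ⟦ whole ⟧
    _∩ᵒ_  : Opn → Opn → Opn
    ∩-spec : ∀ U V x → (x ∈ ⟦ U ∩ᵒ V ⟧ → (x ∈ ⟦ U ⟧ × x ∈ ⟦ V ⟧))
                     × ((x ∈ ⟦ U ⟧ × x ∈ ⟦ V ⟧) → x ∈ ⟦ U ∩ᵒ V ⟧)
    ⋃     : {I : Set} → (I → Opn) → Opn
    ⋃-spec : ∀ {I : Set} (U : I → Opn) x → (x ∈ ⟦ ⋃ U ⟧ → ∃ λ i → x ∈ ⟦ U i ⟧)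
                                         × ((∃ λ i → x ∈ ⟦ U i ⟧) → x ∈ ⟦ ⋃ U ⟧)

module _ (B : Space) where
  open Space B

  -- Presheaf of sets on the opens of B (sets modelled as setoids); functor
  -- from the poset of opens (U ⊆ V) to sets, so the restriction map does not
  -- depend on the chosen inclusion proof.
  record Presheaf : Set₁ where
    field
      F₀      : Opn → Setoid 0ℓ 0ℓ
    Car : Opn → Set
    Car U = Setoid.Carrier (F₀ U)
    Eq : (U : Opn) → Car U → Car U → Set
    Eq U = Setoid._≈_ (F₀ U)
    field
      res     : ∀ {U V} → ⟦ V ⟧ ⊆ ⟦ U ⟧ → Car U → Car V
      res-cong : ∀ {U V} (p : ⟦ V ⟧ ⊆ ⟦ U ⟧) {s t} → Eq U s t → Eq V (res p s) (res p t)
      res-irr : ∀ {U V} (p q : ⟦ V ⟧ ⊆ ⟦ U ⟧) s → Eq V (res p s) (res q s)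
      res-id  : ∀ {U} (p : ⟦ U ⟧ ⊆ ⟦ U ⟧) s → Eq U (res p s) s
      res-∘   : ∀ {U V W} (p : ⟦ V ⟧ ⊆ ⟦ U ⟧) (q : ⟦ W ⟧ ⊆ ⟦ V ⟧) (r : ⟦ W ⟧ ⊆ ⟦ U ⟧) s
                → Eq W (res r s) (res q (res p s))

  open Presheaf

  record Mor (F G : Presheaf) : Set where
    field
      η      : ∀ U → Car F U → Car G U
      η-cong : ∀ U {s t} → Eq F U s t → Eq G U (η U s) (η U t)
      η-nat  : ∀ {U V} (p : ⟦ V ⟧ ⊆ ⟦ U ⟧) s → Eq G V (η V (res F p s)) (res G p (η U s))

  record _≅_ (F G : Presheaf) : Set where
    field
      to   : Mor F G
      from : Mor G F
      to∘from : ∀ U s → Eq G U (Mor.η to U (Mor.η from U s)) s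
      from∘to : ∀ U s → Eq F U (Mor.η from U (Mor.η to U s)) s

  -- Elements of Hom(F,G)(U): presheaf morphisms F|_U → G|_U.
  record HomAt (F G : Presheaf) (U : Opn) : Set where
    field
      η      : ∀ V → ⟦ V ⟧ ⊆ ⟦ U ⟧ → Car F V → Car G V
      η-irr  : ∀ V (p q : ⟦ V ⟧ ⊆ ⟦ U ⟧) s → Eq G V (η V p s) (η V q s)
      η-cong : ∀ V (p : ⟦ V ⟧ ⊆ ⟦ U ⟧) {s t} → Eq F V s t → Eq G V (η V p s) (η V p t)
      η-nat  : ∀ V W (p : ⟦ V ⟧ ⊆ ⟦ U ⟧) (q : ⟦ W ⟧ ⊆ ⟦ U ⟧) (r : ⟦ W ⟧ ⊆ ⟦ V ⟧) s
               → Eq G W (η W q (res F r s)) (res G r (η V p s))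

  open HomAt

  HomSetoid : (F G : Presheaf) → Opn → Setoid 0ℓ 0ℓ
  HomSetoid F G U = record
    { Carrier = HomAt F G U
    ; _≈_ = λ h k → ∀ V (p : ⟦ V ⟧ ⊆ ⟦ U ⟧) s → Eq G V (η h V p s) (η k V p s)
    ; isEquivalence = record
      { refl = λ V p s → Setoid.refl (F₀ G V)
      ; sym = λ e V p s → Setoid.sym (F₀ G V) (e V p s)
      ; trans = λ e e' V p s → Setoid.trans (F₀ G V) (e V p s) (e' V p s) } }

  Hom : Presheaf → Presheaf → Presheaf
  Hom F G = record
    { F₀ = HomSetoid F G
    ; res = λ {U} {V} r h → record
        { η = λ W q → η h W (λ x → r (q x))
        ; η-irr = λ W p q s → η-irr h W _ _ s
        ; η-cong = λ W p e → η-cong h W _ e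
        ; η-nat = λ V' W p q r' s → η-nat h V' W _ _ r' s }
    ; res-cong = λ p e V q s → e V _ s
    ; res-irr = λ p q h V r s → η-irr h V _ _ s
    ; res-id = λ p h V r s → η-irr h V _ _ s
    ; res-∘ = λ p q r h V t s → η-irr h V _ _ s }

  Char : Opn → Presheaf
  Char W = record
    { F₀ = λ V → record
        { Carrier = ⟦ V ⟧ ⊆ ⟦ W ⟧
        ; _≈_ = λ _ _ → ⊤
        ; isEquivalence = record { refl = tt ; sym = λ _ → tt ; trans = λ _ _ → tt } }
    ; res = λ r s x → s (r x)
    ; res-cong = λ _ _ → tt
    ; res-irr = λ _ _ _ → tt
    ; res-id = λ _ _ → tt
    ; res-∘ = λ _ _ _ _ → tt }

  ∅ᵒ : Opn
  ∅ᵒ = ⋃ {I = Data.Empty.⊥} (λ ())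
    where import Data.Empty

  Supp : Presheaf → Opn
  Supp F = ⋃ {I = Σ Opn (Car F)} proj₁

  Int : Pred Pt 0ℓ → Opn
  Int S = ⋃ {I = Σ Opn (λ V → ⟦ V ⟧ ⊆ S)} proj₁

module Submission where

-- Both presheaves are "propositional": any two sections over the same open
-- are equal (Char W has a trivial equality, and so does every Hom into it).
-- An isomorphism between propositional presheaves is therefore the same as
-- a pair of maps between their sections in each direction (`prop-iso`);
-- naturality and the inverse laws hold automatically.
--
-- It remains to compare when the sections exist.  A morphism F|_U → Char W|_U
-- exists iff every open V ⊆ U carrying a section of F lies in W, i.e. iff
-- U ∩ Supp F ⊆ W (`Hom-Char-sound`, `Hom-Char-complete`).  For W = ∅ this
-- says U ⊆ B ∖ Supp F, and since U is open that means U ⊆ Int(B ∖ Supp F)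
-- (`Int-greatest`, `Int-deflationary`), which is exactly when
-- Char(Int(B ∖ Supp F))(U) is inhabited.

open import Defs
open import Relation.Unary using (Pred; _∈_; _∉_; _⊆_; _∩_; ∁)
open import Data.Product using (_,_; proj₁; proj₂)
open import Data.Unit using (tt)
open import Level using (0ℓ)
open import Data.Empty using (⊥-elim)

module _ (B : Space) where
  open Space B
  open Presheaf

  ∩ᵒ-intro : ∀ {U V x} → x ∈ ⟦ U ⟧ → x ∈ ⟦ V ⟧ → x ∈ ⟦ U ∩ᵒ V ⟧
  ∩ᵒ-intro {U} {V} xU xV = proj₂ (∩-spec U V _) (xU , xV)

  ∩ᵒ-left : ∀ {U V} → ⟦ U ∩ᵒ V ⟧ ⊆ ⟦ U ⟧
  ∩ᵒ-left {U} {V} x∈ = proj₁ (proj₁ (∩-spec U V _) x∈)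

  ∩ᵒ-right : ∀ {U V} → ⟦ U ∩ᵒ V ⟧ ⊆ ⟦ V ⟧
  ∩ᵒ-right {U} {V} x∈ = proj₂ (proj₁ (∩-spec U V _) x∈)

  ∅ᵒ-empty : ∀ {x} → x ∉ ⟦ ∅ᵒ B ⟧
  ∅ᵒ-empty {x} x∈ with proj₁ (⋃-spec _ x) x∈
  ... | () , _

  Supp-intro : (F : Presheaf B) (V : Opn) → Car F V → ⟦ V ⟧ ⊆ ⟦ Supp B F ⟧
  Supp-intro F V s {x} xV = proj₂ (⋃-spec _ x) ((V , s) , xV)

  Int-deflationary : (S : Pred Pt 0ℓ) → ⟦ Int B S ⟧ ⊆ S
  Int-deflationary S {x} x∈ with proj₁ (⋃-spec _ x) x∈
  ... | (V , V⊆S) , xV = V⊆S xV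

  Int-greatest : (S : Pred Pt 0ℓ) (V : Opn) → ⟦ V ⟧ ⊆ S → ⟦ V ⟧ ⊆ ⟦ Int B S ⟧
  Int-greatest S V V⊆S {x} xV = proj₂ (⋃-spec _ x) ((V , (λ {y} → V⊆S {y})) , xV)

  -- A morphism F|_U → Char W|_U forces U ∩ Supp F ⊆ W: a point of U ∩ Supp F
  -- lies in some V carrying a section s, and the morphism sends s|_{V ∩ U}
  -- to the proof that V ∩ U ⊆ W.
  Hom-Char-sound : (F : Presheaf B) (W U : Opn)
    → HomAt B F (Char B W) U → ⟦ U ⟧ ∩ ⟦ Supp B F ⟧ ⊆ ⟦ W ⟧
  Hom-Char-sound F W U h {x} (xU , xSupp) with proj₁ (⋃-spec _ x) xSupp
  ... | (V , s) , xV =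
    HomAt.η h (V ∩ᵒ U) ∩ᵒ-right (res F ∩ᵒ-left s) (∩ᵒ-intro xV xU)

  Hom-Char-complete : (F : Presheaf B) (W U : Opn)
    → ⟦ U ⟧ ∩ ⟦ Supp B F ⟧ ⊆ ⟦ W ⟧ → HomAt B F (Char B W) U
  Hom-Char-complete F W U U∩Supp⊆W = record
    { η = λ V V⊆U s xV → U∩Supp⊆W (V⊆U xV , Supp-intro F V s xV)
    ; η-irr = λ _ _ _ _ → tt
    ; η-cong = λ _ _ _ → tt
    ; η-nat = λ _ _ _ _ _ _ → tt }

  IsPropositional : Presheaf B → Set
  IsPropositional G = ∀ U (s t : Car G U) → Eq G U s t

  Char-propositional : (W : Opn) → IsPropositional (Char B W)
  Char-propositional W _ _ _ = tt

  Hom-propositional : (F G : Presheaf B)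
    → IsPropositional G → IsPropositional (Hom B F G)
  Hom-propositional F G G-prop U h k V _ s = G-prop V _ _

  prop-iso : (G H : Presheaf B) → IsPropositional G → IsPropositional H
    → (∀ U → Car G U → Car H U) → (∀ U → Car H U → Car G U) → _≅_ B G H
  prop-iso G H G-prop H-prop to from = record
    { to = record { η = to ; η-cong = λ U _ → H-prop U _ _ ; η-nat = λ {_} {V} _ _ → H-prop V _ _ }
    ; from = record { η = from ; η-cong = λ U _ → G-prop U _ _ ; η-nat = λ {_} {V} _ _ → G-prop V _ _ }
    ; to∘from = λ U _ → H-prop U _ _
    ; from∘to = λ U _ → G-prop U _ _ }

corollary6p11 : (B : Space) (F : Presheaf B)
    → _≅_ B (Hom B F (Char B (∅ᵒ B))) (Char B (Int B (∁ (Space.⟦_⟧ B (Supp B F)))))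
corollary6p11 B F =
  prop-iso B (Hom B F (Char B ∅)) (Char B (Int B Outside))
    (Hom-propositional B F (Char B ∅) (Char-propositional B ∅))
    (Char-propositional B (Int B Outside))
    to from
  where
  open Space B using (Opn; Pt; ⟦_⟧)
  ∅ : Opn
  ∅ = ∅ᵒ B
  Outside : Pred Pt 0ℓ
  Outside = ∁ ⟦ Supp B F ⟧

  to : ∀ U → HomAt B F (Char B ∅) U → ⟦ U ⟧ ⊆ ⟦ Int B Outside ⟧
  to U h = Int-greatest B Outside U
    (λ xU xSupp → ∅ᵒ-empty B (Hom-Char-sound B F ∅ U h (xU , xSupp)))

  from : ∀ U → ⟦ U ⟧ ⊆ ⟦ Int B Outside ⟧ → HomAt B F (Char B ∅) U
  from U U⊆Int = Hom-Char-complete B F ∅ U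
    (λ (xU , xSupp) → ⊥-elim (Int-deflationary B Outside (U⊆Int xU) xSupp))
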